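{- Let $G$ be a strongly regular graph with parameters $(76,21,2,7)$ and let $u$ be a vertex of $G$. The subgraph induced on $G_1(u)$ is a disjoint union of cycles $C_1,\dots,C_r$. Let $w\in G_2(u)$ and, for each $i$, let $s_i$ be the number of neighbours of $w$ on $C_i$. Then the length $t_i$ of $C_i$ equals $3s_i$; in particular it is a multiple of $3$.
   Context: A graph is strongly regular with parameters $(v,k,\lambda,\mu)$ if it has $v$ vertices, every vertex has $k$ neighbours, any two adjacent vertices have exactly $\lambda$ common neighbours, and any two distinct non-adjacent vertices have exactly $\mu$ common neighbours. $G_1(u)$ denotes the set of neighbours of $u$ and $G_2(u)$ the set of vertices at distance $2$ from $u$. Since $\lambda=2$, the subgraph induced on $G_1(u)$ is $2$-regular, hence a disjoint union of cycles. -}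

module Defs where

open import Data.Nat using (ℕ; zero; suc; _+_)
open import Data.Bool using (Bool; true; false; if_then_else_; _∧_; not)
open import Data.Fin using (Fin)
open import Data.List using (List; map; allFin)
open import Data.Nat.ListAction using (sum)
open import Data.Product using (Σ; _×_; ∃-syntax)
open import Relation.Binary.PropositionalEquality using (_≡_; _≢_)
open import Relation.Nullary using (¬_)

record Graph (n : ℕ) : Set where
  field
    adj       : Fin n → Fin n → Bool
    adj-sym   : ∀ x y → adj x y ≡ adj y x
    adj-irrefl : ∀ x → adj x x ≡ false
open Graph public

count : ∀ {n} → (Fin n → Bool) → ℕ
count {n} P = sum (map (λ x → if P x then 1 else 0) (allFin n))

common : ∀ {n} → Graph n → Fin n → Fin n → ℕ
common G x y = count (λ z → adj G x z ∧ adj G z y)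

degree : ∀ {n} → Graph n → Fin n → ℕ
degree G x = count (adj G x)

record IsSRG (v : ℕ) (G : Graph v) (k l m : ℕ) : Set where
  field
    regular  : ∀ x → degree G x ≡ k
    lambda   : ∀ x y → adj G x y ≡ true → common G x y ≡ l
    mu       : ∀ x y → x ≢ y → adj G x y ≡ false → common G x y ≡ m

InG2 : ∀ {n} → Graph n → Fin n → Fin n → Set
InG2 G u w = (w ≢ u) × (adj G u w ≡ false) × ∃[ z ] ((adj G u z ≡ true) × (adj G z w ≡ true))

data ReachIn {n} (G : Graph n) (u : Fin n) (x : Fin n) : Fin n → Set where
  here : ReachIn G u x x
  step : ∀ {y z} → ReachIn G u x y → adj G y z ≡ true → adj G u z ≡ true → ReachIn G u x z

-- C (as a Boolean predicate) is the vertex set of the connected component of x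
-- in the subgraph induced on G₁(u), where x ∈ G₁(u).
IsComponentOf : ∀ {n} → Graph n → Fin n → Fin n → (Fin n → Bool) → Set
IsComponentOf G u x C = ∀ y → (C y ≡ true → ReachIn G u x y) × (ReachIn G u x y → C y ≡ true)

-- The adjacency operator A of
-- an SRG(v,k,λ,μ) satisfies A² = μJ + (k-μ)I + (λ-μ)A, so for an eigenvalue r
-- (a root of r² = (λ-μ)r + (k-μ)) the operator B = A - rI satisfies
-- B² = μJ + (λ-μ-2r)B.  For (76,21,2,7) and r = 2 this reads B² = 7J - 9B.
--
-- Given u, a component C of G₁(u) with t = |C| vertices, put
-- F = 21·𝟙_C - t·𝟙_{G₁(u)}.  Then ΣF = 0, so B²F = -9·BF.  A direct count shows
-- BF vanishes on G₁(u) (every y ∈ G₁(u) has exactly λ = 2 neighbours in G₁(u),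
-- all in the component of y), while F vanishes off G₁(u); hence F·BF = 0
-- pointwise.  Since B is self-adjoint, ⟨BF,BF⟩ = ⟨F,B²F⟩ = -9⟨F,BF⟩ = 0, so
-- BF = 0.  Evaluating at w ∈ G₂(u) gives 21·s - 7·t = 0, i.e. t = 3s.

module Submission where

open import Defs
open import Data.Nat using (ℕ; _*_)
open import Data.Bool using (Bool; true; _∧_)
open import Data.Fin using (Fin)
open import Relation.Binary.PropositionalEquality using (_≡_)

open import Data.Bool using (false; if_then_else_)
open import Data.Bool.Properties using (∧-comm; ∧-idem; ∧-identityʳ; ∧-zeroʳ; ⇔→≡)
open import Data.Fin using (zero; suc)
open import Data.Fin.Properties using (_≟_)
open import Data.Integer using (ℤ; +_; -[1+_]; 0ℤ; ∣_∣; -_; _-_)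
  renaming (_+_ to _⊕_; _*_ to _⊗_)
import Data.Integer.Properties as ℤP
open import Data.Integer.Tactic.RingSolver using (solve-∀)
import Data.Nat as ℕ
import Data.Nat.Properties as ℕP
open import Data.List using (tabulate)
open import Data.List.Properties using (map-tabulate)
import Data.Nat.ListAction as List
open import Data.Product using (_,_; proj₁; proj₂)
open import Data.Sum using ([_,_]′)
open import Function using (_∘_; id; mk⇔)
open import Relation.Nullary using (yes; no; does)
open import Relation.Binary.PropositionalEquality
  using (_≢_; refl; sym; trans; cong; cong₂; module ≡-Reasoning)
open import Algebra.Properties.Semiring.Sum ℤP.+-*-semiring
  using (sum; sum-cong-≗; ∑-distrib-+; *-distribˡ-sum; *-distribʳ-sum; ∑-comm; sum-replicate-zero)

⟦_⟧ : Bool → ℤ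
⟦ b ⟧ = + (if b then 1 else 0)

⟦∧⟧ : ∀ a b → ⟦ a ∧ b ⟧ ≡ ⟦ a ⟧ ⊗ ⟦ b ⟧
⟦∧⟧ true  true  = refl
⟦∧⟧ true  false = refl
⟦∧⟧ false _     = refl

sum-scale : ∀ {n} c (f : Fin n → ℤ) → sum (λ i → c ⊗ f i) ≡ c ⊗ sum f
sum-scale c f = sym (*-distribˡ-sum c f)

sum-linear : ∀ {n} a b (f g : Fin n → ℤ) →
             sum (λ i → a ⊗ f i ⊕ b ⊗ g i) ≡ a ⊗ sum f ⊕ b ⊗ sum g
sum-linear a b f g =
  trans (∑-distrib-+ (λ i → a ⊗ f i) (λ i → b ⊗ g i)) (cong₂ _⊕_ (sum-scale a f) (sum-scale b g))

sum-delta : ∀ {n} (i : Fin n) (f : Fin n → ℤ) → sum (λ j → ⟦ does (i ≟ j) ⟧ ⊗ f j) ≡ f i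
sum-delta {ℕ.suc n} zero f = begin
    + 1 ⊗ f zero ⊕ sum (λ j → 0ℤ ⊗ f (suc j))
  ≡⟨ cong₂ _⊕_ (ℤP.*-identityˡ (f zero)) (sum-cong-≗ (λ j → ℤP.*-zeroˡ (f (suc j)))) ⟩
    f zero ⊕ sum {n} (λ _ → 0ℤ)
  ≡⟨ cong (f zero ⊕_) (sum-replicate-zero n) ⟩
    f zero ⊕ 0ℤ
  ≡⟨ ℤP.+-identityʳ (f zero) ⟩
    f zero ∎
  where open ≡-Reasoning
sum-delta (suc i) f =
  trans (cong (_⊕ sum (λ j → ⟦ does (i ≟ j) ⟧ ⊗ f (suc j))) (ℤP.*-zeroˡ (f zero)))
        (trans (ℤP.+-identityˡ _) (sum-delta i (f ∘ suc)))

sum-naturals : ∀ {n} (h : Fin n → ℕ) → sum (λ i → + h i) ≡ + List.sum (tabulate h)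
sum-naturals {ℕ.zero}  h = refl
sum-naturals {ℕ.suc n} h =
  trans (cong (+ h zero ⊕_) (sum-naturals (h ∘ suc))) (sym (ℤP.pos-+ (h zero) _))

count-as-sum : ∀ {n} (P : Fin n → Bool) → + count P ≡ sum (⟦_⟧ ∘ P)
count-as-sum P =
  trans (cong (+_ ∘ List.sum) (map-tabulate id (λ x → if P x then 1 else 0)))
        (sym (sum-naturals (λ x → if P x then 1 else 0)))

count-cong : ∀ {n} {P Q : Fin n → Bool} → (∀ x → P x ≡ Q x) → count P ≡ count Q
count-cong {P = P} {Q} P≗Q =
  ℤP.+-injective (trans (count-as-sum P) (trans (sum-cong-≗ (cong ⟦_⟧ ∘ P≗Q)) (sym (count-as-sum Q))))

count-guard : ∀ {n} b (P : Fin n → Bool) → + count (λ z → b ∧ P z) ≡ ⟦ b ⟧ ⊗ + count P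
count-guard     true  P = sym (ℤP.*-identityˡ (+ count P))
count-guard {n} false P = trans (count-as-sum (λ z → false ∧ P z)) (sum-replicate-zero n)

square-abs : ∀ i → i ⊗ i ≡ + (∣ i ∣ ℕ.* ∣ i ∣)
square-abs (+ n)    = ℤP.+◃n≡+n (n ℕ.* n)
square-abs -[1+ n ] = ℤP.+◃n≡+n (ℕ.suc n ℕ.* ℕ.suc n)

tabulate-sum-zero : ∀ {n} (h : Fin n → ℕ) → List.sum (tabulate h) ≡ 0 → ∀ i → h i ≡ 0
tabulate-sum-zero h Σ≡0 zero    = ℕP.m+n≡0⇒m≡0 (h zero) Σ≡0
tabulate-sum-zero h Σ≡0 (suc i) = tabulate-sum-zero (h ∘ suc) (ℕP.m+n≡0⇒n≡0 (h zero) Σ≡0) i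

sum-squares-zero : ∀ {n} (g : Fin n → ℤ) → sum (λ i → g i ⊗ g i) ≡ 0ℤ → ∀ i → g i ≡ 0ℤ
sum-squares-zero g Σ≡0 i =
  [ id , id ]′ (ℤP.i*j≡0⇒i≡0∨j≡0 (g i) square≡0)
  where
    h : Fin _ → ℕ
    h j = ∣ g j ∣ ℕ.* ∣ g j ∣
    square≡0 : g i ⊗ g i ≡ 0ℤ
    square≡0 = trans (square-abs (g i)) (cong +_ (tabulate-sum-zero h
      (ℤP.+-injective (trans (sym (sum-naturals h))
        (trans (sum-cong-≗ (sym ∘ square-abs ∘ g)) Σ≡0))) i))

Op : ℕ → Set
Op n = (Fin n → ℤ) → Fin n → ℤ

SelfAdjoint : ∀ {n} → Op n → Set
SelfAdjoint B = ∀ f h → sum (λ y → h y ⊗ B f y) ≡ sum (λ y → B h y ⊗ f y)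

_-I*_ : ∀ {n} → Op n → ℤ → Op n
(B -I* r) f y = B f y - r ⊗ f y

shift-self-adjoint : ∀ {n} (B : Op n) r → SelfAdjoint B → SelfAdjoint (B -I* r)
shift-self-adjoint B r B-sa f h = begin
    sum (λ y → h y ⊗ (B f y - r ⊗ f y))
  ≡⟨ sum-cong-≗ (λ y → expand r (h y) (B f y) (f y)) ⟩
    sum (λ y → + 1 ⊗ (h y ⊗ B f y) ⊕ (- r) ⊗ (h y ⊗ f y))
  ≡⟨ sum-linear (+ 1) (- r) (λ y → h y ⊗ B f y) (λ y → h y ⊗ f y) ⟩
    + 1 ⊗ sum (λ y → h y ⊗ B f y) ⊕ (- r) ⊗ sum (λ y → h y ⊗ f y)
  ≡⟨ cong (λ p → + 1 ⊗ p ⊕ (- r) ⊗ sum (λ y → h y ⊗ f y)) (B-sa f h) ⟩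
    + 1 ⊗ sum (λ y → B h y ⊗ f y) ⊕ (- r) ⊗ sum (λ y → h y ⊗ f y)
  ≡⟨ sym (sum-linear (+ 1) (- r) (λ y → B h y ⊗ f y) (λ y → h y ⊗ f y)) ⟩
    sum (λ y → + 1 ⊗ (B h y ⊗ f y) ⊕ (- r) ⊗ (h y ⊗ f y))
  ≡⟨ sum-cong-≗ (λ y → sym (collect r (B h y) (h y) (f y))) ⟩
    sum (λ y → (B h y - r ⊗ h y) ⊗ f y) ∎
  where
    open ≡-Reasoning
    expand : ∀ r a b c → a ⊗ (b - r ⊗ c) ≡ + 1 ⊗ (a ⊗ b) ⊕ (- r) ⊗ (a ⊗ c)
    expand = solve-∀
    collect : ∀ r a b c → (a - r ⊗ b) ⊗ c ≡ + 1 ⊗ (a ⊗ c) ⊕ (- r) ⊗ (b ⊗ c)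
    collect = solve-∀

-- Key lemma: if B is self-adjoint, B²f = c·Bf and f·Bf vanishes pointwise,
-- then Bf = 0, because ⟨Bf,Bf⟩ = ⟨f,B²f⟩ = c·⟨f,Bf⟩ = 0.
self-adjoint-vanishing : ∀ {n} (B : Op n) → SelfAdjoint B → ∀ c f →
  (∀ y → B (B f) y ≡ c ⊗ B f y) → (∀ y → f y ⊗ B f y ≡ 0ℤ) → ∀ y → B f y ≡ 0ℤ
self-adjoint-vanishing {n} B B-sa c f B²f f⊥Bf = sum-squares-zero (B f) (begin
    sum (λ y → B f y ⊗ B f y)
  ≡⟨ sym (B-sa (B f) f) ⟩
    sum (λ y → f y ⊗ B (B f) y)
  ≡⟨ sum-cong-≗ (λ y → trans (cong (f y ⊗_) (B²f y)) (reorder (f y) c (B f y))) ⟩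
    sum (λ y → c ⊗ (f y ⊗ B f y))
  ≡⟨ sum-scale c (λ y → f y ⊗ B f y) ⟩
    c ⊗ sum (λ y → f y ⊗ B f y)
  ≡⟨ cong (c ⊗_) (trans (sum-cong-≗ f⊥Bf) (sum-replicate-zero n)) ⟩
    c ⊗ 0ℤ
  ≡⟨ ℤP.*-zeroʳ c ⟩
    0ℤ ∎)
  where
    open ≡-Reasoning
    reorder : ∀ a b d → a ⊗ (b ⊗ d) ≡ b ⊗ (a ⊗ d)
    reorder = solve-∀

module Adjacency {n} (G : Graph n) where

  A : Op n
  A f y = sum (λ z → ⟦ adj G y z ⟧ ⊗ f z)

  A-cong : ∀ {f g} → (∀ z → f z ≡ g z) → ∀ y → A f y ≡ A g y
  A-cong f≗g y = sum-cong-≗ (λ z → cong (⟦ adj G y z ⟧ ⊗_) (f≗g z))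

  A-linear : ∀ p q f g y → A (λ z → p ⊗ f z ⊕ q ⊗ g z) y ≡ p ⊗ A f y ⊕ q ⊗ A g y
  A-linear p q f g y =
    trans (sum-cong-≗ (λ z → distribute p q ⟦ adj G y z ⟧ (f z) (g z)))
          (sum-linear p q (λ z → ⟦ adj G y z ⟧ ⊗ f z) (λ z → ⟦ adj G y z ⟧ ⊗ g z))
    where
      distribute : ∀ p q a b c → a ⊗ (p ⊗ b ⊕ q ⊗ c) ≡ p ⊗ (a ⊗ b) ⊕ q ⊗ (a ⊗ c)
      distribute = solve-∀

  A-indicator : ∀ (P : Fin n → Bool) y → A (⟦_⟧ ∘ P) y ≡ + count (λ z → adj G y z ∧ P z)
  A-indicator P y =
    trans (sum-cong-≗ (λ z → sym (⟦∧⟧ (adj G y z) (P z)))) (sym (count-as-sum (λ z → adj G y z ∧ P z)))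

  A-self-adjoint : SelfAdjoint A
  A-self-adjoint f h = begin
      sum (λ y → h y ⊗ A f y)
    ≡⟨ sum-cong-≗ (λ y → *-distribˡ-sum (h y) (λ z → ⟦ adj G y z ⟧ ⊗ f z)) ⟩
      sum (λ y → sum (λ z → h y ⊗ (⟦ adj G y z ⟧ ⊗ f z)))
    ≡⟨ ∑-comm (λ y z → h y ⊗ (⟦ adj G y z ⟧ ⊗ f z)) ⟩
      sum (λ z → sum (λ y → h y ⊗ (⟦ adj G y z ⟧ ⊗ f z)))
    ≡⟨ sum-cong-≗ (λ z → sum-cong-≗ (λ y → transpose y z)) ⟩
      sum (λ z → sum (λ y → (⟦ adj G z y ⟧ ⊗ h y) ⊗ f z))
    ≡⟨ sum-cong-≗ (λ z → sym (*-distribʳ-sum (f z) (λ y → ⟦ adj G z y ⟧ ⊗ h y))) ⟩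
      sum (λ z → A h z ⊗ f z) ∎
    where
      open ≡-Reasoning
      reorder : ∀ a b c → a ⊗ (b ⊗ c) ≡ (b ⊗ a) ⊗ c
      reorder = solve-∀
      transpose : ∀ y z → h y ⊗ (⟦ adj G y z ⟧ ⊗ f z) ≡ (⟦ adj G z y ⟧ ⊗ h y) ⊗ f z
      transpose y z = trans (reorder (h y) ⟦ adj G y z ⟧ (f z)) (cong (λ b → (⟦ b ⟧ ⊗ h y) ⊗ f z) (adj-sym G y z))

  A-twice : ∀ f y → A (A f) y ≡ sum (λ y' → + common G y y' ⊗ f y')
  A-twice f y = begin
      sum (λ z → ⟦ adj G y z ⟧ ⊗ sum (λ y' → ⟦ adj G z y' ⟧ ⊗ f y'))
    ≡⟨ sum-cong-≗ (λ z → *-distribˡ-sum ⟦ adj G y z ⟧ (λ y' → ⟦ adj G z y' ⟧ ⊗ f y')) ⟩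
      sum (λ z → sum (λ y' → ⟦ adj G y z ⟧ ⊗ (⟦ adj G z y' ⟧ ⊗ f y')))
    ≡⟨ ∑-comm (λ z y' → ⟦ adj G y z ⟧ ⊗ (⟦ adj G z y' ⟧ ⊗ f y')) ⟩
      sum (λ y' → sum (λ z → ⟦ adj G y z ⟧ ⊗ (⟦ adj G z y' ⟧ ⊗ f y')))
    ≡⟨ sum-cong-≗ (λ y' → sum-cong-≗ (λ z → sym (ℤP.*-assoc ⟦ adj G y z ⟧ _ (f y')))) ⟩
      sum (λ y' → sum (λ z → (⟦ adj G y z ⟧ ⊗ ⟦ adj G z y' ⟧) ⊗ f y'))
    ≡⟨ sum-cong-≗ (λ y' → sym (*-distribʳ-sum (f y') (λ z → ⟦ adj G y z ⟧ ⊗ ⟦ adj G z y' ⟧))) ⟩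
      sum (λ y' → A (λ z → ⟦ adj G z y' ⟧) y ⊗ f y')
    ≡⟨ sum-cong-≗ (λ y' → cong (_⊗ f y') (A-indicator (λ z → adj G z y') y)) ⟩
      sum (λ y' → + common G y y' ⊗ f y') ∎
    where open ≡-Reasoning

module StronglyRegular {n} (G : Graph n) {k l m : ℕ} (srg : IsSRG n G k l m) where
  open Adjacency G
  open IsSRG srg

  common-self : ∀ y → common G y y ≡ k
  common-self y =
    trans (count-cong (λ z → trans (cong (adj G y z ∧_) (adj-sym G z y)) (∧-idem _))) (regular y)

  common-formula : ∀ y y' →
    + common G y y' ≡ + m ⊕ (+ k - + m) ⊗ ⟦ does (y ≟ y') ⟧ ⊕ (+ l - + m) ⊗ ⟦ adj G y y' ⟧
  common-formula y y' with y ≟ y'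
  ... | yes refl rewrite adj-irrefl G y = trans (cong +_ (common-self y)) (diagonal (+ k) (+ m) (+ l))
    where
      diagonal : ∀ K M L → K ≡ M ⊕ (K - M) ⊗ + 1 ⊕ (L - M) ⊗ 0ℤ
      diagonal = solve-∀
  ... | no y≢y' with adj G y y' in y~y'
  ...   | true  = trans (cong +_ (lambda y y' y~y')) (adjacent (+ k) (+ m) (+ l))
    where
      adjacent : ∀ K M L → L ≡ M ⊕ (K - M) ⊗ 0ℤ ⊕ (L - M) ⊗ + 1
      adjacent = solve-∀
  ...   | false = trans (cong +_ (mu y y' y≢y' y~y')) (non-adjacent (+ k) (+ m) (+ l))
    where
      non-adjacent : ∀ K M L → M ≡ M ⊕ (K - M) ⊗ 0ℤ ⊕ (L - M) ⊗ 0ℤ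
      non-adjacent = solve-∀

  A-squared : ∀ f y → A (A f) y ≡ + m ⊗ sum f ⊕ (+ k - + m) ⊗ f y ⊕ (+ l - + m) ⊗ A f y
  A-squared f y = begin
      A (A f) y
    ≡⟨ A-twice f y ⟩
      sum (λ y' → + common G y y' ⊗ f y')
    ≡⟨ sum-cong-≗ (λ y' → trans (cong (_⊗ f y') (common-formula y y'))
                                (expand (+ m) (+ k) (+ l) (δ y') (a y') (f y'))) ⟩
      sum (λ y' → + m ⊗ f y' ⊕ ((+ k - + m) ⊗ (δ y' ⊗ f y') ⊕ (+ l - + m) ⊗ (a y' ⊗ f y')))
    ≡⟨ ∑-distrib-+ (λ y' → + m ⊗ f y')
                   (λ y' → (+ k - + m) ⊗ (δ y' ⊗ f y') ⊕ (+ l - + m) ⊗ (a y' ⊗ f y')) ⟩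
      sum (λ y' → + m ⊗ f y') ⊕ sum (λ y' → (+ k - + m) ⊗ (δ y' ⊗ f y') ⊕ (+ l - + m) ⊗ (a y' ⊗ f y'))
    ≡⟨ cong₂ _⊕_ (sum-scale (+ m) f)
                 (sum-linear (+ k - + m) (+ l - + m) (λ y' → δ y' ⊗ f y') (λ y' → a y' ⊗ f y')) ⟩
      + m ⊗ sum f ⊕ ((+ k - + m) ⊗ sum (λ y' → δ y' ⊗ f y') ⊕ (+ l - + m) ⊗ A f y)
    ≡⟨ cong (λ d → + m ⊗ sum f ⊕ ((+ k - + m) ⊗ d ⊕ (+ l - + m) ⊗ A f y)) (sum-delta y f) ⟩
      + m ⊗ sum f ⊕ ((+ k - + m) ⊗ f y ⊕ (+ l - + m) ⊗ A f y)
    ≡⟨ sym (ℤP.+-assoc (+ m ⊗ sum f) ((+ k - + m) ⊗ f y) ((+ l - + m) ⊗ A f y)) ⟩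
      + m ⊗ sum f ⊕ (+ k - + m) ⊗ f y ⊕ (+ l - + m) ⊗ A f y ∎
    where
      open ≡-Reasoning
      δ a : Fin n → ℤ
      δ y' = ⟦ does (y ≟ y') ⟧
      a y' = ⟦ adj G y y' ⟧
      expand : ∀ M K L d e v → (M ⊕ (K - M) ⊗ d ⊕ (L - M) ⊗ e) ⊗ v
                               ≡ M ⊗ v ⊕ ((K - M) ⊗ (d ⊗ v) ⊕ (L - M) ⊗ (e ⊗ v))
      expand = solve-∀

  shifted-square : ∀ r → r ⊗ r ≡ (+ l - + m) ⊗ r ⊕ (+ k - + m) → ∀ f y →
    (A -I* r) ((A -I* r) f) y ≡ + m ⊗ sum f ⊕ ((+ l - + m) - + 2 ⊗ r) ⊗ (A -I* r) f y
  shifted-square r eigen f y = begin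
      A (λ z → A f z - r ⊗ f z) y - r ⊗ (A f y - r ⊗ f y)
    ≡⟨ cong (_- r ⊗ (A f y - r ⊗ f y))
         (trans (A-cong (λ z → as-combination r (A f z) (f z)) y) (A-linear (+ 1) (- r) (A f) f y)) ⟩
      + 1 ⊗ A (A f) y ⊕ (- r) ⊗ A f y - r ⊗ (A f y - r ⊗ f y)
    ≡⟨ cong (λ a → + 1 ⊗ a ⊕ (- r) ⊗ A f y - r ⊗ (A f y - r ⊗ f y)) (A-squared f y) ⟩
      + 1 ⊗ (+ m ⊗ sum f ⊕ (+ k - + m) ⊗ f y ⊕ (+ l - + m) ⊗ A f y) ⊕ (- r) ⊗ A f y
        - r ⊗ (A f y - r ⊗ f y)
    ≡⟨ regroup (+ k - + m) (+ l - + m) r (+ m ⊗ sum f) (A f y) (f y) ⟩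
      + m ⊗ sum f ⊕ ((+ l - + m) - + 2 ⊗ r) ⊗ (A f y - r ⊗ f y)
        ⊕ (((+ l - + m) ⊗ r ⊕ (+ k - + m)) - r ⊗ r) ⊗ f y
    ≡⟨ vanishing-term residual (f y) ⟩
      + m ⊗ sum f ⊕ ((+ l - + m) - + 2 ⊗ r) ⊗ (A f y - r ⊗ f y) ∎
    where
      open ≡-Reasoning
      residual : ((+ l - + m) ⊗ r ⊕ (+ k - + m)) - r ⊗ r ≡ 0ℤ
      residual = trans (cong (λ q → ((+ l - + m) ⊗ r ⊕ (+ k - + m)) - q) eigen)
                       (ℤP.+-inverseʳ ((+ l - + m) ⊗ r ⊕ (+ k - + m)))
      vanishing-term : ∀ {a e} → e ≡ 0ℤ → ∀ v → a ⊕ e ⊗ v ≡ a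
      vanishing-term {a} refl v = trans (cong (a ⊕_) (ℤP.*-zeroˡ v)) (ℤP.+-identityʳ a)
      as-combination : ∀ r a v → a - r ⊗ v ≡ + 1 ⊗ a ⊕ (- r) ⊗ v
      as-combination = solve-∀
      regroup : ∀ K L r s a v →
        + 1 ⊗ (s ⊕ K ⊗ v ⊕ L ⊗ a) ⊕ (- r) ⊗ a - r ⊗ (a - r ⊗ v)
          ≡ s ⊕ (L - + 2 ⊗ r) ⊗ (a - r ⊗ v) ⊕ ((L ⊗ r ⊕ K) - r ⊗ r) ⊗ v
      regroup = solve-∀

module Component {n} (G : Graph n) (u x : Fin n) (ux : adj G u x ≡ true)
                 (C : Fin n → Bool) (comp : IsComponentOf G u x C) where

  reach-in-G₁ : ∀ {y} → ReachIn G u x y → adj G u y ≡ true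
  reach-in-G₁ here           = ux
  reach-in-G₁ (step _ _ u~z) = u~z

  component-⊆-G₁ : ∀ {y} → C y ≡ true → adj G u y ≡ true
  component-⊆-G₁ {y} y∈C = reach-in-G₁ (proj₁ (comp y) y∈C)

  outside-G₁ : ∀ {y} → adj G u y ≡ false → C y ≡ false
  outside-G₁ {y} u≁y with C y in y∈C
  ... | false = refl
  ... | true with trans (sym u≁y) (component-⊆-G₁ y∈C)
  ...   | ()

  component-closed : ∀ {y z} → adj G u y ≡ true → adj G u z ≡ true → adj G y z ≡ true → C y ≡ C z
  component-closed {y} {z} u~y u~z y~z = ⇔→≡ {z = true} (mk⇔ to from)
    where
      to : C y ≡ true → C z ≡ true
      to y∈C = proj₂ (comp z) (step (proj₁ (comp y) y∈C) y~z u~z)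
      from : C z ≡ true → C y ≡ true
      from z∈C = proj₂ (comp y) (step (proj₁ (comp z) z∈C) (trans (adj-sym G z y) y~z) u~y)

  component-neighbours : ∀ {y} → adj G u y ≡ true → ∀ z →
    (adj G y z ∧ C z) ≡ C y ∧ (adj G y z ∧ adj G z u)
  component-neighbours {y} u~y z rewrite adj-sym G z u with adj G y z in y~z
  ... | false = sym (∧-zeroʳ (C y))
  ... | true with adj G u z in u~z
  ...   | true  = trans (sym (component-closed u~y u~z y~z)) (sym (∧-identityʳ (C y)))
  ...   | false = trans (outside-G₁ u~z) (sym (∧-zeroʳ (C y)))

module CycleLength (G : Graph 76) (srg : IsSRG 76 G 21 2 7)
                   (u x : Fin 76) (ux : adj G u x ≡ true)
                   (C : Fin 76 → Bool) (comp : IsComponentOf G u x C) where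
  open IsSRG srg
  open Adjacency G
  open StronglyRegular G srg
  open Component G u x ux C comp

  -- B = A - 2I; 2 is the positive restricted eigenvalue of SRG(76,21,2,7).
  B : Op 76
  B = A -I* (+ 2)

  t : ℤ
  t = + count C

  F : Fin 76 → ℤ
  F y = + 21 ⊗ ⟦ C y ⟧ ⊕ (- t) ⊗ ⟦ adj G u y ⟧

  -- ΣF = 21·t - t·k = 0 since |G₁(u)| = k = 21.
  F-sum : sum F ≡ 0ℤ
  F-sum = begin
      sum F
    ≡⟨ sum-linear (+ 21) (- t) (⟦_⟧ ∘ C) (⟦_⟧ ∘ adj G u) ⟩
      + 21 ⊗ sum (⟦_⟧ ∘ C) ⊕ (- t) ⊗ sum (⟦_⟧ ∘ adj G u)
    ≡⟨ cong₂ (λ p q → + 21 ⊗ p ⊕ (- t) ⊗ q)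
         (sym (count-as-sum C)) (trans (sym (count-as-sum (adj G u))) (cong +_ (regular u))) ⟩
      + 21 ⊗ t ⊕ (- t) ⊗ + 21
    ≡⟨ cancel t ⟩
      0ℤ ∎
    where
      open ≡-Reasoning
      cancel : ∀ s → + 21 ⊗ s ⊕ (- s) ⊗ + 21 ≡ 0ℤ
      cancel = solve-∀

  -- Since ΣF = 0, the identity B² = 7J - 9B gives B²F = -9·BF.
  B-squared-F : ∀ y → B (B F) y ≡ - + 9 ⊗ B F y
  B-squared-F y = begin
      B (B F) y
    ≡⟨ shifted-square (+ 2) refl F y ⟩
      + 7 ⊗ sum F ⊕ - + 9 ⊗ B F y
    ≡⟨ cong (λ s → + 7 ⊗ s ⊕ - + 9 ⊗ B F y) F-sum ⟩
      0ℤ ⊕ - + 9 ⊗ B F y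
    ≡⟨ ℤP.+-identityˡ (- + 9 ⊗ B F y) ⟩
      - + 9 ⊗ B F y ∎
    where open ≡-Reasoning

  AF : ∀ y → A F y ≡ + 21 ⊗ + count (λ z → adj G y z ∧ C z) ⊕ (- t) ⊗ + common G y u
  AF y =
    trans (A-linear (+ 21) (- t) (⟦_⟧ ∘ C) (⟦_⟧ ∘ adj G u) y)
          (cong₂ (λ p q → + 21 ⊗ p ⊕ (- t) ⊗ q) (A-indicator C y)
            (trans (A-indicator (adj G u) y)
              (cong +_ (count-cong (λ z → cong (adj G y z ∧_) (adj-sym G u z))))))

  -- On G₁(u): a vertex of C has λ = 2 neighbours in C, a vertex outside C none.
  BF-on-G₁ : ∀ y → adj G u y ≡ true → B F y ≡ 0ℤ
  BF-on-G₁ y u~y = begin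
      A F y - + 2 ⊗ F y
    ≡⟨ cong (_- + 2 ⊗ F y) (AF y) ⟩
      + 21 ⊗ + count (λ z → adj G y z ∧ C z) ⊕ (- t) ⊗ + common G y u - + 2 ⊗ F y
    ≡⟨ cong (λ c → + 21 ⊗ c ⊕ (- t) ⊗ + common G y u - + 2 ⊗ F y)
         (trans (cong +_ (count-cong (component-neighbours u~y)))
                (count-guard (C y) (λ z → adj G y z ∧ adj G z u))) ⟩
      + 21 ⊗ (⟦ C y ⟧ ⊗ + common G y u) ⊕ (- t) ⊗ + common G y u
        - + 2 ⊗ (+ 21 ⊗ ⟦ C y ⟧ ⊕ (- t) ⊗ ⟦ adj G u y ⟧)
    ≡⟨ cong₂ (λ c a → + 21 ⊗ (⟦ C y ⟧ ⊗ c) ⊕ (- t) ⊗ c - + 2 ⊗ (+ 21 ⊗ ⟦ C y ⟧ ⊕ (- t) ⊗ ⟦ a ⟧))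
         (cong +_ (lambda y u (trans (adj-sym G y u) u~y))) u~y ⟩
      + 21 ⊗ (⟦ C y ⟧ ⊗ + 2) ⊕ (- t) ⊗ + 2 - + 2 ⊗ (+ 21 ⊗ ⟦ C y ⟧ ⊕ (- t) ⊗ + 1)
    ≡⟨ cancel ⟦ C y ⟧ t ⟩
      0ℤ ∎
    where
      open ≡-Reasoning
      cancel : ∀ c s → + 21 ⊗ (c ⊗ + 2) ⊕ (- s) ⊗ + 2 - + 2 ⊗ (+ 21 ⊗ c ⊕ (- s) ⊗ + 1) ≡ 0ℤ
      cancel = solve-∀

  -- Off G₁(u) both indicators in F vanish, since C ⊆ G₁(u).
  F-off-G₁ : ∀ y → adj G u y ≡ false → F y ≡ 0ℤ
  F-off-G₁ y u≁y = trans (cong₂ (λ c a → + 21 ⊗ ⟦ c ⟧ ⊕ (- t) ⊗ ⟦ a ⟧) (outside-G₁ u≁y) u≁y)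
                         (vanish t)
    where
      vanish : ∀ s → + 21 ⊗ 0ℤ ⊕ (- s) ⊗ 0ℤ ≡ 0ℤ
      vanish = solve-∀

  F-⊥-BF : ∀ y → F y ⊗ B F y ≡ 0ℤ
  F-⊥-BF y = by-membership (adj G u y) refl
    where
      by-membership : ∀ b → adj G u y ≡ b → F y ⊗ B F y ≡ 0ℤ
      by-membership true  u~y = trans (cong (F y ⊗_) (BF-on-G₁ y u~y)) (ℤP.*-zeroʳ (F y))
      by-membership false u≁y = trans (cong (_⊗ B F y) (F-off-G₁ y u≁y)) (ℤP.*-zeroˡ (B F y))

  BF-zero : ∀ y → B F y ≡ 0ℤ
  BF-zero = self-adjoint-vanishing B (shift-self-adjoint A (+ 2) A-self-adjoint)
              (- + 9) F B-squared-F F-⊥-BF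

  -- Evaluating BF = 0 at a vertex w ∈ G₂(u): there F(w) = 0 and w has μ = 7
  -- common neighbours with u, so 0 = BF(w) = 21·s - 7·t.
  component-size : ∀ w → w ≢ u → adj G u w ≡ false →
                   count C ≡ 3 * count (λ z → C z ∧ adj G w z)
  component-size w w≢u u≁w = ℤP.+-injective (begin
      t
    ≡⟨ ℤP.*-cancelˡ-≡ (+ 7) t (+ 3 ⊗ s) (solve-for-t t s (trans (sym BF-at-w) (BF-zero w))) ⟩
      + 3 ⊗ s
    ≡⟨ sym (ℤP.pos-* 3 (count (λ z → adj G w z ∧ C z))) ⟩
      + (3 * count (λ z → adj G w z ∧ C z))
    ≡⟨ cong (+_ ∘ (3 *_)) (count-cong (λ z → ∧-comm (adj G w z) (C z))) ⟩
      + (3 * count (λ z → C z ∧ adj G w z)) ∎)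
    where
      open ≡-Reasoning
      s : ℤ
      s = + count (λ z → adj G w z ∧ C z)
      BF-at-w : B F w ≡ + 21 ⊗ s ⊕ (- t) ⊗ + 7 - + 2 ⊗ 0ℤ
      BF-at-w = cong₂ (λ a f → a - + 2 ⊗ f)
                  (trans (AF w) (cong (λ c → + 21 ⊗ s ⊕ (- t) ⊗ + c)
                                      (mu w u w≢u (trans (adj-sym G w u) u≁w))))
                  (F-off-G₁ w u≁w)
      solve-for-t : ∀ t s → + 21 ⊗ s ⊕ (- t) ⊗ + 7 - + 2 ⊗ 0ℤ ≡ 0ℤ → + 7 ⊗ t ≡ + 7 ⊗ (+ 3 ⊗ s)
      solve-for-t t s BFw≡0 =
        sym (trans (rearrange t s) (trans (cong (_⊕ + 7 ⊗ t) BFw≡0) (ℤP.+-identityˡ (+ 7 ⊗ t))))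
        where
          rearrange : ∀ t s → + 7 ⊗ (+ 3 ⊗ s) ≡ (+ 21 ⊗ s ⊕ (- t) ⊗ + 7 - + 2 ⊗ 0ℤ) ⊕ + 7 ⊗ t
          rearrange = solve-∀

lemma2 : (G : Graph 76) → IsSRG 76 G 21 2 7 →
         (u w : Fin 76) → InG2 G u w →
         (x : Fin 76) → adj G u x ≡ true →
         (C : Fin 76 → Bool) → IsComponentOf G u x C →
         count C ≡ 3 * count (λ y → C y ∧ adj G w y)
lemma2 G srg u w (w≢u , u≁w , _) x ux C comp =
  CycleLength.component-size G srg u x ux C comp w w≢u u≁w
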